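{- Let $q$ be a power of an odd prime with $q\equiv 1\pmod 3$, and let $R$ be the graph defined below over $\mathbb F_q$. Then: (i) any two vertices of $R$ at distance $2$ have distinct first components; (ii) for $b,c,r,s\in\mathbb F_q$ with $b\neq c$, the points $(0,b,r)$ and $(0,c,s)$ are at distance $4$ in $R$; (iii) for $x,y,r,s\in\mathbb F_q$ with $r\neq s$, the lines $[x,y,r]$ and $[x,y,s]$ (respectively, the points $(x,y,r)$ and $(x,y,s)$) are at distance at least $6$ in $R$.
   Context: $R$ is the bipartite graph whose parts are the set of points $(p_1,p_2,p_3)\in\mathbb F_q^3$ and the set of lines $[l_1,l_2,l_3]\in\mathbb F_q^3$ (two disjoint copies of $\mathbb F_q^3$), where $(p_1,p_2,p_3)$ is adjacent to $[l_1,l_2,l_3]$ if and only if $p_2+l_2 = p_1l_1$ and $p_3+l_3 = p_1p_2l_1(p_1+p_2+p_1p_2)$. Distance means graph distance in $R$. -}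

module Defs where

open import Level using (0ℓ)
open import Data.Nat using (ℕ; zero; suc; _<_; _^_)
open import Data.Nat.Primality using (Prime)
open import Data.Fin using (Fin)
open import Data.Product using (Σ; ∃; _×_; _,_)
open import Data.Empty using (⊥)
open import Data.Sum using (_⊎_; inj₁; inj₂)
open import Relation.Nullary using (¬_)
open import Relation.Binary.PropositionalEquality using (_≡_; _≢_)
open import Algebra.Structures using (IsCommutativeRing)
open import Function.Bundles using (_↔_)

OddPrimePower : ℕ → Set
OddPrimePower q = Σ ℕ λ p → Σ ℕ λ k → Prime p × p ≢ 2 × q ≡ p ^ suc k

record FiniteField (q : ℕ) : Set₁ where
  infixl 7 _*_
  infixl 6 _+_
  field
    Carrier : Set
    _+_ _*_ : Carrier → Carrier → Carrier
    -_ : Carrier → Carrier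
    0# 1# : Carrier
    isCommutativeRing : IsCommutativeRing _≡_ _+_ _*_ -_ 0# 1#
    0≢1 : 0# ≢ 1#
    inverse : ∀ x → x ≢ 0# → Σ Carrier λ y → x * y ≡ 1#
    enumeration : Fin q ↔ Carrier

module Graph {q : ℕ} (F : FiniteField q) where
  open FiniteField F

  record Triple : Set where
    constructor ⟨_,_,_⟩
    field
      c₁ c₂ c₃ : Carrier

  Vertex : Set
  Vertex = Triple ⊎ Triple

  point : Carrier → Carrier → Carrier → Vertex
  point a b c = inj₁ ⟨ a , b , c ⟩

  line : Carrier → Carrier → Carrier → Vertex
  line a b c = inj₂ ⟨ a , b , c ⟩

  Incident : Triple → Triple → Set
  Incident ⟨ p₁ , p₂ , p₃ ⟩ ⟨ l₁ , l₂ , l₃ ⟩ =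
    (p₂ + l₂ ≡ p₁ * l₁) ×
    (p₃ + l₃ ≡ p₁ * p₂ * l₁ * (p₁ + p₂ + p₁ * p₂))

  Adj : Vertex → Vertex → Set
  Adj (inj₁ p) (inj₂ l) = Incident p l
  Adj (inj₂ l) (inj₁ p) = Incident p l
  Adj (inj₁ _) (inj₁ _) = ⊥
  Adj (inj₂ _) (inj₂ _) = ⊥

  data Walk : ℕ → Vertex → Vertex → Set where
    [] : ∀ {v} → Walk zero v v
    _∷_ : ∀ {n u w v} → Adj u w → Walk n w v → Walk (suc n) u v

  Dist : ℕ → Vertex → Vertex → Set
  Dist d u v = Walk d u v × (∀ m → m < d → ¬ Walk m u v)

  -- graph distance is at least d (includes the case of no path at all)
  DistAtLeast : ℕ → Vertex → Vertex → Set
  DistAtLeast d u v = ∀ m → m < d → ¬ Walk m u v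

  firstComponent : Vertex → Carrier
  firstComponent (inj₁ ⟨ a , _ , _ ⟩) = a
  firstComponent (inj₂ ⟨ a , _ , _ ⟩) = a

-- Forgetting third coordinates maps R onto the graph on F_q² in which (a , u) and
-- (b , v) are adjacent iff u + v = a b, and the third coordinate of a neighbour in R
-- is determined by the vertex and the first two coordinates of the neighbour. In
-- that quotient graph two neighbours of a vertex with the same first coordinate
-- coincide, and two vertices with distinct first coordinates have at most one
-- common neighbour. So a walk of length 2 between vertices with equal first
-- coordinates, or of length 4 between vertices with equal first two coordinates,
-- returns to its start, while walks of odd length change sides. For (ii) the path runs
-- through a point with first coordinate -1, where the cubic term of the incidence
-- becomes linear: p₁ p₂ l₁ (p₁ + p₂ + p₁ p₂) = p₂ l₁.

module Submission where

open import Defs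
open import Level using (0ℓ)
open import Algebra.Bundles using (CommutativeRing)
open import Data.Bool using (Bool; true; false; not; _xor_)
open import Data.Bool.Properties using (not-¬; not-distribˡ-xor; not-distribʳ-xor)
import Data.Fin.Properties as Fin
open import Data.Nat using (ℕ; zero; suc; _%_; z≤n; s≤s)
open import Data.Product using (Σ; _×_; _,_; proj₁; proj₂)
open import Data.Sum using (inj₁; inj₂)
open import Function.Base using (_∘_)
open import Function.Properties.Inverse using (↔-sym; ↔⇒↣)
open import Relation.Binary.Definitions using (DecidableEquality)
open import Relation.Binary.PropositionalEquality
  using (_≡_; _≢_; refl; sym; trans; cong; cong₂; subst; module ≡-Reasoning)
open import Relation.Nullary.Decidable using (yes; no; via-injection)

module _ {q : ℕ} (F : FiniteField q) where
  open FiniteField F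
  open Graph F
  open ≡-Reasoning

  commutativeRing : CommutativeRing 0ℓ 0ℓ
  commutativeRing = record { isCommutativeRing = isCommutativeRing }

  open CommutativeRing commutativeRing
    using (_-_; +-comm; +-identityˡ; +-identityʳ; zeroˡ; -‿inverseʳ; -‿inverseˡ; *-assoc; *-comm; *-identityˡ; *-identityʳ; distribˡ; commutativeSemiring)
  open import Algebra.Properties.Ring (CommutativeRing.ring commutativeRing)
    using (+-cancelˡ; +-cancelʳ; -‿+-comm; -‿involutive; -1*x≈-x; -‿distribˡ-*; [y-z]x≈yx-zx; x∙y⁻¹≈ε⇒x≈y; xyx⁻¹≈y; //-rightDividesʳ; ⁻¹-anti-homo‿-)
  open import Algebra.Solver.Ring.NaturalCoefficients.Default commutativeSemiring
    using (solve; _:=_; _:+_)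

  _≟_ : DecidableEquality Carrier
  _≟_ = via-injection (↔⇒↣ (↔-sym enumeration)) Fin._≟_

  *-cancelˡ : ∀ {z x y} → z ≢ 0# → z * x ≡ z * y → x ≡ y
  *-cancelˡ {z} {x} {y} z≢0 zx≡zy with inverse z z≢0
  ... | z⁻¹ , zz⁻¹≡1 = begin
    x              ≡⟨ sym (unit x) ⟩
    z⁻¹ * (z * x)  ≡⟨ cong (z⁻¹ *_) zx≡zy ⟩
    z⁻¹ * (z * y)  ≡⟨ unit y ⟩
    y              ∎
    where
    unit : ∀ t → z⁻¹ * (z * t) ≡ t
    unit t = begin
      z⁻¹ * (z * t)  ≡⟨ sym (*-assoc z⁻¹ z t) ⟩
      z⁻¹ * z * t    ≡⟨ cong (_* t) (trans (*-comm z⁻¹ z) zz⁻¹≡1) ⟩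
      1# * t         ≡⟨ *-identityˡ t ⟩
      t              ∎

  x≢y⇒x-y≢0 : ∀ {x y} → x ≢ y → x - y ≢ 0#
  x≢y⇒x-y≢0 {x} {y} x≢y = x≢y ∘ x∙y⁻¹≈ε⇒x≈y x y

  Adj₂ : Carrier × Carrier → Carrier × Carrier → Set
  Adj₂ X Y = proj₂ X + proj₂ Y ≡ proj₁ X * proj₁ Y

  Adj₂-sym : ∀ {X Y} → Adj₂ X Y → Adj₂ Y X
  Adj₂-sym {X} {Y} XY = trans (+-comm (proj₂ Y) (proj₂ X)) (trans XY (*-comm (proj₁ X) (proj₁ Y)))

  Adj₂-neighbour-unique : ∀ {X Y Z} → Adj₂ X Z → Adj₂ Y Z → proj₁ X ≡ proj₁ Y → X ≡ Y
  Adj₂-neighbour-unique {a , u} {.a , u'} {Z} XZ YZ refl =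
    cong (a ,_) (+-cancelʳ (proj₂ Z) u u' (trans XZ (sym YZ)))

  Adj₂-slope : ∀ {a u a' u' Z} → Adj₂ (a , u) Z → Adj₂ (a' , u') Z →
               (a - a') * proj₁ Z ≡ u - u'
  Adj₂-slope {a} {u} {a'} {u'} {z , w} XZ YZ = begin
    (a - a') * z           ≡⟨ [y-z]x≈yx-zx z a a' ⟩
    a * z - a' * z         ≡⟨ cong₂ _-_ (sym XZ) (sym YZ) ⟩
    (u + w) - (u' + w)     ≡⟨ cong ((u + w) +_) (sym (-‿+-comm u' w)) ⟩
    (u + w) + (- u' + - w) ≡⟨ solve 4 (λ u w u' w' → (u :+ w) :+ (u' :+ w') := (u :+ u') :+ (w :+ w')) refl u w (- u') (- w) ⟩
    (u - u') + (w - w)     ≡⟨ cong ((u - u') +_) (-‿inverseʳ w) ⟩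
    (u - u') + 0#          ≡⟨ +-identityʳ (u - u') ⟩
    u - u'                 ∎

  Adj₂-common-neighbour-unique : ∀ {X Y Z W} → proj₁ X ≢ proj₁ Y →
    Adj₂ X Z → Adj₂ Y Z → Adj₂ X W → Adj₂ Y W → Z ≡ W
  Adj₂-common-neighbour-unique X₁≢Y₁ XZ YZ XW YW =
    Adj₂-neighbour-unique (Adj₂-sym XZ) (Adj₂-sym XW)
      (*-cancelˡ (x≢y⇒x-y≢0 X₁≢Y₁) (trans (Adj₂-slope XZ YZ) (sym (Adj₂-slope XW YW))))

  secondComponent : Vertex → Carrier
  secondComponent (inj₁ ⟨ _ , b , _ ⟩) = b
  secondComponent (inj₂ ⟨ _ , b , _ ⟩) = b

  firstTwo : Vertex → Carrier × Carrier
  firstTwo u = firstComponent u , secondComponent u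

  Adj-sym : ∀ {u v} → Adj u v → Adj v u
  Adj-sym {inj₁ _} {inj₂ _} uv = uv
  Adj-sym {inj₂ _} {inj₁ _} uv = uv

  Adj⇒Adj₂ : ∀ {u v} → Adj u v → Adj₂ (firstTwo u) (firstTwo v)
  Adj⇒Adj₂ {inj₁ _} {inj₂ _} (uv₂ , _) = uv₂
  Adj⇒Adj₂ {inj₂ _} {inj₁ _} (vu₂ , _) = Adj₂-sym vu₂

  neighbour-unique : ∀ {u v w} → Adj u w → Adj v w → firstTwo u ≡ firstTwo v → u ≡ v
  neighbour-unique {inj₁ ⟨ _ , _ , α ⟩} {inj₁ ⟨ _ , _ , α' ⟩} {inj₂ ⟨ _ , _ , l₃ ⟩} (_ , uw) (_ , vw) refl
    with +-cancelʳ l₃ α α' (trans uw (sym vw))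
  ... | refl = refl
  neighbour-unique {inj₂ ⟨ _ , _ , l₃ ⟩} {inj₂ ⟨ _ , _ , l₃' ⟩} {inj₁ ⟨ _ , _ , α ⟩} (_ , uw) (_ , vw) refl
    with +-cancelˡ α l₃ l₃' (trans uw (sym vw))
  ... | refl = refl

  neighbour-unique-firstComponent : ∀ {u v w} → Adj u w → Adj v w →
    firstComponent u ≡ firstComponent v → u ≡ v
  neighbour-unique-firstComponent uw vw u₁≡v₁ =
    neighbour-unique uw vw (Adj₂-neighbour-unique (Adj⇒Adj₂ uw) (Adj⇒Adj₂ vw) u₁≡v₁)

  walk₂-unique : ∀ {u v} → Walk 2 u v → firstComponent u ≡ firstComponent v → u ≡ v
  walk₂-unique (uw ∷ (wv ∷ [])) = neighbour-unique-firstComponent uw (Adj-sym wv)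

  square-unique : ∀ {u w₁ w₂ w₃ v} → Adj u w₁ → Adj w₁ w₂ → Adj w₂ w₃ → Adj w₃ v →
    firstTwo u ≡ firstTwo v → u ≡ v
  square-unique {u} {w₁} {w₂} {w₃} {v} e₁ e₂ e₃ e₄ u≈v with firstComponent w₁ ≟ firstComponent w₃
  ... | yes w₁₁≡w₃₁ = neighbour-unique e₁ (subst (Adj v) (sym w₁≡w₃) (Adj-sym e₄)) u≈v
    where
    w₁≡w₃ : w₁ ≡ w₃
    w₁≡w₃ = neighbour-unique-firstComponent e₂ (Adj-sym e₃) w₁₁≡w₃₁
  ... | no w₁₁≢w₃₁ = trans u≡w₂ w₂≡v
    where
    w₂≈u : firstTwo w₂ ≡ firstTwo u
    w₂≈u = Adj₂-common-neighbour-unique w₁₁≢w₃₁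
      (Adj⇒Adj₂ e₂) (Adj⇒Adj₂ (Adj-sym e₃))
      (Adj⇒Adj₂ (Adj-sym e₁)) (subst (Adj₂ (firstTwo w₃)) (sym u≈v) (Adj⇒Adj₂ e₄))
    u≡w₂ : u ≡ w₂
    u≡w₂ = neighbour-unique e₁ (Adj-sym e₂) (sym w₂≈u)
    w₂≡v : w₂ ≡ v
    w₂≡v = neighbour-unique e₃ (Adj-sym e₄) (trans w₂≈u u≈v)

  walk₄-unique : ∀ {u v} → Walk 4 u v → firstTwo u ≡ firstTwo v → u ≡ v
  walk₄-unique (e₁ ∷ (e₂ ∷ (e₃ ∷ (e₄ ∷ [])))) = square-unique e₁ e₂ e₃ e₄

  side : Vertex → Bool
  side (inj₁ _) = true
  side (inj₂ _) = false

  odd : ℕ → Bool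
  odd zero    = false
  odd (suc n) = not (odd n)

  Adj-flips-side : ∀ {u v} → Adj u v → side v ≡ not (side u)
  Adj-flips-side {inj₁ _} {inj₂ _} _ = refl
  Adj-flips-side {inj₂ _} {inj₁ _} _ = refl

  walk-side : ∀ {n u v} → Walk n u v → side v ≡ odd n xor side u
  walk-side [] = refl
  walk-side {suc n} {u} {v} (_∷_ {w = w} uw wv) = begin
    side v                       ≡⟨ walk-side wv ⟩
    odd n xor side w             ≡⟨ cong (odd n xor_) (Adj-flips-side uw) ⟩
    odd n xor not (side u)       ≡⟨ sym (not-distribʳ-xor (odd n) (side u)) ⟩
    not (odd n xor side u)       ≡⟨ not-distribˡ-xor (odd n) (side u) ⟩
    not (odd n) xor side u       ∎

  odd-walk-flips-side : ∀ {n u v} → odd n ≡ true → Walk n u v → side u ≢ side v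
  odd-walk-flips-side {u = u} n-odd w u≈v =
    not-¬ refl (trans u≈v (trans (walk-side w) (cong (_xor side u) n-odd)))

  dist₂-firstComponent : ∀ {u v} → Dist 2 u v → firstComponent u ≢ firstComponent v
  dist₂-firstComponent {u} (w , shortest) u₁≡v₁ =
    shortest 0 (s≤s z≤n) (subst (Walk 0 u) (walk₂-unique w u₁≡v₁) [])

  distAtLeast4 : ∀ {u v} → side u ≡ side v → firstComponent u ≡ firstComponent v → u ≢ v →
    DistAtLeast 4 u v
  distAtLeast4 _   _     u≢v 0 _ [] = u≢v refl
  distAtLeast4 u≈v _     _   1 _ w  = odd-walk-flips-side refl w u≈v
  distAtLeast4 _   u₁≡v₁ u≢v 2 _ w  = u≢v (walk₂-unique w u₁≡v₁)
  distAtLeast4 u≈v _     _   3 _ w  = odd-walk-flips-side refl w u≈v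
  distAtLeast4 _   _     _   (suc (suc (suc (suc _)))) (s≤s (s≤s (s≤s (s≤s ())))) _

  distAtLeast6 : ∀ {u v} → side u ≡ side v → firstTwo u ≡ firstTwo v → u ≢ v →
    DistAtLeast 6 u v
  distAtLeast6 _   _        u≢v 0 _ [] = u≢v refl
  distAtLeast6 u≈v _        _   1 _ w  = odd-walk-flips-side refl w u≈v
  distAtLeast6 _   u₁₂≡v₁₂ u≢v 2 _ w  = u≢v (walk₂-unique w (cong proj₁ u₁₂≡v₁₂))
  distAtLeast6 u≈v _        _   3 _ w  = odd-walk-flips-side refl w u≈v
  distAtLeast6 _   u₁₂≡v₁₂ u≢v 4 _ w  = u≢v (walk₄-unique w u₁₂≡v₁₂)
  distAtLeast6 u≈v _        _   5 _ w  = odd-walk-flips-side refl w u≈v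
  distAtLeast6 _   _        _   (suc (suc (suc (suc (suc (suc _)))))) (s≤s (s≤s (s≤s (s≤s (s≤s (s≤s ())))))) _

  quotient : ∀ {a} → a ≢ 0# → ∀ y → Σ Carrier λ t → t * a ≡ y
  quotient {a} a≢0 y with inverse a a≢0
  ... | a⁻¹ , aa⁻¹≡1 = y * a⁻¹ , (begin
    y * a⁻¹ * a    ≡⟨ *-assoc y a⁻¹ a ⟩
    y * (a⁻¹ * a)  ≡⟨ cong (y *_) (trans (*-comm a⁻¹ a) aa⁻¹≡1) ⟩
    y * 1#         ≡⟨ *-identityʳ y ⟩
    y              ∎)

  telescope : ∀ x y z → (x - y) + (y - z) ≡ x - z
  telescope x y z = begin
    (x - y) + (y - z)       ≡⟨ solve 4 (λ x y y' z → (x :+ y') :+ (y :+ z) := x :+ ((y' :+ y) :+ z)) refl x y (- y) (- z) ⟩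
    x + ((- y + y) + - z)   ≡⟨ cong (λ e → x + (e + - z)) (-‿inverseˡ y) ⟩
    x + (0# + - z)          ≡⟨ cong (x +_) (+-identityˡ (- z)) ⟩
    x - z                   ∎

  origin-adj : ∀ b r x → Adj (point 0# b r) (line x (- b) (- r))
  origin-adj b r x = trans (-‿inverseʳ b) (sym (zeroˡ x))
                   , trans (-‿inverseʳ r) (sym (begin
    0# * b * x * (0# + b + 0# * b)  ≡⟨ cong (λ e → e * x * (0# + b + e)) (zeroˡ b) ⟩
    0# * x * (0# + b + 0#)          ≡⟨ cong (_* (0# + b + 0#)) (zeroˡ x) ⟩
    0# * (0# + b + 0#)              ≡⟨ zeroˡ _ ⟩
    0#                              ∎))

  minus-one-weight : ∀ t x → - 1# * t * x * (- 1# + t + - 1# * t) ≡ t * x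
  minus-one-weight t x = begin
    - 1# * t * x * (- 1# + t + - 1# * t)  ≡⟨ cong (λ e → e * x * (- 1# + t + e)) (-1*x≈-x t) ⟩
    - t * x * (- 1# + t + - t)            ≡⟨ cong (- t * x *_) (//-rightDividesʳ t (- 1#)) ⟩
    - t * x * - 1#                        ≡⟨ *-comm (- t * x) (- 1#) ⟩
    - 1# * (- t * x)                      ≡⟨ -1*x≈-x (- t * x) ⟩
    - (- t * x)                           ≡⟨ cong -_ (sym (-‿distribˡ-* t x)) ⟩
    - - (t * x)                           ≡⟨ -‿involutive (t * x) ⟩
    t * x                                 ∎

  pivot-adj : ∀ {t p b r} → p - r ≡ t * (b - t) → Adj (point (- 1#) t p) (line (b - t) (- b) (- r))
  pivot-adj {t} {p} {b} {r} p-r≡t[b-t] =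
      sym (trans (-1*x≈-x (b - t)) (⁻¹-anti-homo‿- b t))
    , trans p-r≡t[b-t] (sym (minus-one-weight t (b - t)))

  origin-walk₄ : ∀ {b c} r s → b ≢ c → Walk 4 (point 0# b r) (point 0# c s)
  origin-walk₄ {b} {c} r s b≢c =
      _∷_ {w = line (b - t) (- b) (- r)} (origin-adj b r (b - t))
    ( _∷_ {w = point (- 1#) t p}         (pivot-adj p-r)
    ( _∷_ {w = line (c - t) (- c) (- s)} (pivot-adj p-s)
    ( origin-adj c s (c - t) ∷ [])))
    where
    t : Carrier
    t = proj₁ (quotient (x≢y⇒x-y≢0 (b≢c ∘ sym)) (r - s))
    t[c-b]≡r-s : t * (c - b) ≡ r - s
    t[c-b]≡r-s = proj₂ (quotient (x≢y⇒x-y≢0 (b≢c ∘ sym)) (r - s))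
    p : Carrier
    p = r + t * (b - t)
    p-r : p - r ≡ t * (b - t)
    p-r = xyx⁻¹≈y r (t * (b - t))
    p-s : p - s ≡ t * (c - t)
    p-s = begin
      (r + t * (b - t)) - s          ≡⟨ solve 3 (λ r x s → (r :+ x) :+ s := (r :+ s) :+ x) refl r (t * (b - t)) (- s) ⟩
      (r - s) + t * (b - t)          ≡⟨ cong (_+ t * (b - t)) (sym t[c-b]≡r-s) ⟩
      t * (c - b) + t * (b - t)      ≡⟨ sym (distribˡ t (c - b) (b - t)) ⟩
      t * ((c - b) + (b - t))        ≡⟨ cong (t *_) (telescope c b t) ⟩
      t * (c - t)                    ∎

lemma4p1 : (q : ℕ) → OddPrimePower q → q % 3 ≡ 1 → (F : FiniteField q) →
    let open FiniteField F
        open Graph F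
    in ((u v : Vertex) → Dist 2 u v → firstComponent u ≢ firstComponent v)
     × ((b c r s : Carrier) → b ≢ c → Dist 4 (point 0# b r) (point 0# c s))
     × ((x y r s : Carrier) → r ≢ s →
          DistAtLeast 6 (line x y r) (line x y s)
        × DistAtLeast 6 (point x y r) (point x y s))
lemma4p1 q _ _ F =
    (λ u v → dist₂-firstComponent F)
  , (λ b c r s b≢c →
        origin-walk₄ F r s b≢c
      , distAtLeast4 F refl refl (b≢c ∘ cong (secondComponent F)))
  , λ x y r s r≢s →
        distAtLeast6 F refl refl (λ { refl → r≢s refl })
      , distAtLeast6 F refl refl (λ { refl → r≢s refl })
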